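{- Let $\underline{R}$ be an arbitrary computation type of EEC. For all simply-typed $\lambda$-terms with $\Theta\vdash M:\tau$ and $\Theta\vdash N:\tau$: if $\Theta\vdash M=_{\beta\eta}N:\tau$, then in EEC $$\Theta^{ln}\multimap\underline R\mid -\vdash M^{ln}=N^{ln}:\tau^{ln}\multimap\underline{R}.$$
   Context: **EEC (enriched effect calculus).** There are value-type constants $\alpha,\beta,\ldots$ and a disjoint set of computation-type constants $\underline{\alpha},\underline{\beta},\ldots$. Value types $A,B,C$ and computation types $\underline{A},\underline{B},\underline{C},\underline{D}$ are generated by $A::=\alpha\mid 1\mid A\times B\mid A\to B\mid \underline{A}\mid \underline{A}\multimap\underline{B}$ and $\underline{A}::=\underline{\alpha}\mid\underline{1}\mid\underline{A}\,\&\,\underline{B}\mid A\Rightarrow\underline{B}\mid\underline{I}\mid\ !A\mid\ !A\otimes\underline{B}\mid\underline{0}\mid\underline{A}\oplus\underline{B}$ (every computation type is also a value type; $!A\otimes\underline{B}$ is one primitive binary constructor). Judgements are $\Gamma\mid -\vdash t:A$ and $\Gamma\mid z{:}\underline{A}\vdash t:\underline{B}$, where $\Gamma$ lists distinct variables with value types and the "stoup" holds at most one variable, of computation type; with nonempty stoup the result type is a computation type. Below $\Delta$ is empty or $z{:}\underline{D}$. Typing rules: $\Gamma,x{:}A\mid-\vdash x:A$; $\Gamma\mid-\vdash *:1$; pairs $\langle t,u\rangle:A\times B$, projections $\pi_1t,\pi_2t$; $\lambda x{:}A.t:A\to B$ from $\Gamma,x{:}A\mid-\vdash t:B$; application $t\,u$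 (all with empty stoup). $\Gamma\mid z{:}\underline A\vdash z:\underline A$; $\Gamma\mid\Delta\vdash\underline{*}:\underline 1$; from $\Gamma\mid\Delta\vdash t:\underline A$, $\Gamma\mid\Delta\vdash u:\underline B$ get $\Gamma\mid\Delta\vdash\langle t,u\rangle_c:\underline A\,\&\,\underline B$, and from $\Gamma\mid\Delta\vdash t:\underline A\,\&\,\underline B$ get $\underline\pi_1t:\underline A$, $\underline\pi_2t:\underline B$; from $\Gamma,x{:}A\mid\Delta\vdash t:\underline B$ get $\Gamma\mid\Delta\vdash\underline\lambda x{:}A.t:A\Rightarrow\underline B$; from $\Gamma\mid\Delta\vdash s:A\Rightarrow\underline B$, $\Gamma\mid-\vdash t:A$ get $\Gamma\mid\Delta\vdash s@t:\underline B$; $\Gamma\mid-\vdash\top:\underline I$; from $\Gamma\mid\Delta\vdash t:\underline I$, $\Gamma\mid-\vdash u:\underline A$ get $\Gamma\mid\Delta\vdash \mathrm{let}\ \top\ \mathrm{be}\ t\ \mathrm{in}\ u:\underline A$; from $\Gamma\mid-\vdash t:A$ get $\Gamma\mid-\vdash\,!t:\,!A$; from $\Gamma\mid\Delta\vdash t:\,!A$, $\Gamma,x{:}A\mid-\vdash u:\underline B$ get $\Gamma\mid\Delta\vdash\mathrm{let}\ !x\ \mathrm{be}\ t\ \mathrm{in}\ u:\underline B$; from $\Gamma\mid-\vdash t:A$, $\Gamma\mid\Delta\vdash u:\underline B$ get $\Gamma\mid\Delta\vdash\,!t\otimes u:\,!A\otimes\underline B$; from $\Gamma\mid\Delta\vdash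 s:\,!A\otimes\underline B$, $\Gamma,x{:}A\mid y{:}\underline B\vdash t:\underline C$ get $\Gamma\mid\Delta\vdash\mathrm{let}\ !x\otimes y\ \mathrm{be}\ s\ \mathrm{in}\ t:\underline C$; from $\Gamma\mid\Delta\vdash t:\underline 0$ get $\Gamma\mid\Delta\vdash\mathrm{abort}_{\underline A}(t):\underline A$; $\mathrm{inl}\,t:\underline A\oplus\underline B$ from $t:\underline A$ and $\mathrm{inr}\,t$ from $t:\underline B$ (same $\Gamma\mid\Delta$); from $\Gamma\mid\Delta\vdash s:\underline A\oplus\underline B$, $\Gamma\mid x{:}\underline A\vdash t:\underline C$, $\Gamma\mid y{:}\underline B\vdash u:\underline C$ get $\Gamma\mid\Delta\vdash\mathrm{case}\ s\ \mathrm{of}\ (\mathrm{inl}\,x\Rightarrow t\mid\mathrm{inr}\,y\Rightarrow u):\underline C$; from $\Gamma\mid z{:}\underline A\vdash t:\underline B$ get $\Gamma\mid-\vdash\hat\lambda z{:}\underline A.t:\underline A\multimap\underline B$; from $\Gamma\mid-\vdash s:\underline A\multimap\underline B$, $\Gamma\mid\Delta\vdash t:\underline A$ get $\Gamma\mid\Delta\vdash s\{t\}:\underline B$. Equality $\Gamma\mid\Delta\vdash t=u:A$ is the least typed congruence (equivalence, compatible with all term formers, containing $\alpha$-equivalence) containing all well-typed instances of: $t=*$ for $t:1$; $\pi_1\langle t,u\rangle=t$, $\pi_2\langle t,u\rangle=u$, $\langle\pi_1t,\pi_2t\rangle=t$; $(\lambda x.t)u=t[u/x]$, $\lambda x.(t\,x)=t$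 ($x$ not free in $t$); $t=\underline*$ for $t:\underline1$; $\underline\pi_1\langle t,u\rangle_c=t$, $\underline\pi_2\langle t,u\rangle_c=u$, $\langle\underline\pi_1t,\underline\pi_2t\rangle_c=t$; $(\underline\lambda x.t)@u=t[u/x]$, $\underline\lambda x.(t@x)=t$ ($x$ not free); $\mathrm{let}\ \top\ \mathrm{be}\ \top\ \mathrm{in}\ t=t$; $\mathrm{let}\ \top\ \mathrm{be}\ t\ \mathrm{in}\ u[\top/x]=u[t/x]$ for $\Gamma\mid x{:}\underline I\vdash u:\underline A$; $\mathrm{let}\ !x\ \mathrm{be}\ !t\ \mathrm{in}\ u=u[t/x]$; $\mathrm{let}\ !x\ \mathrm{be}\ t\ \mathrm{in}\ u[!x/y]=u[t/y]$ for $\Gamma\mid y{:}\,!A\vdash u:\underline B$; $\mathrm{let}\ !x\otimes y\ \mathrm{be}\ !t\otimes s\ \mathrm{in}\ u=u[t/x,s/y]$; $\mathrm{let}\ !x\otimes y\ \mathrm{be}\ t\ \mathrm{in}\ u[(!x\otimes y)/z]=u[t/z]$ for $\Gamma\mid z{:}\,!A\otimes\underline B\vdash u:\underline C$; $\mathrm{abort}_{\underline A}(t)=u[t/x]$ for $\Gamma\mid x{:}\underline 0\vdash u:\underline A$; $\mathrm{case}\ \mathrm{inl}\,t\ \mathrm{of}\ (\mathrm{inl}\,x\Rightarrow u\mid\mathrm{inr}\,y\Rightarrow u')=u[t/x]$ and symmetrically for $\mathrm{inr}$; $\mathrm{case}\ t\ \mathrm{of}\ (\mathrm{inl}\,x\Rightarrow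 u[\mathrm{inl}\,x/z]\mid\mathrm{inr}\,y\Rightarrow u[\mathrm{inr}\,y/z])=u[t/z]$ for $\Gamma\mid z{:}\underline A\oplus\underline B\vdash u:\underline C$; $(\hat\lambda x.t)\{u\}=t[u/x]$, $\hat\lambda x.(t\{x\})=t$ ($x$ not free). **Simply-typed $\lambda$-calculus.** Types $\sigma,\tau::=\alpha\mid 1\mid\sigma\times\tau\mid\sigma\to\tau$; terms $x,*,\langle M,N\rangle,\pi_1M,\pi_2M,\lambda x{:}\sigma.M,M\,N$ with the standard typing in contexts $\Theta=x_1{:}\sigma_1,\ldots,x_n{:}\sigma_n$. $=_{\beta\eta}$ is the standard $\beta\eta$-equality (including $M=*$ for $M:1$ and surjective pairing). Each $\lambda$-calculus type constant $\alpha$ has an associated EEC computation-type constant $\underline\alpha$. **Linear-use cbn CPS translation** (relative to $\underline R$): $\alpha^{ln}=\underline\alpha$, $1^{ln}=\underline 0$, $(\sigma\times\tau)^{ln}=\sigma^{ln}\oplus\tau^{ln}$, $(\sigma\to\tau)^{ln}=\,!(\sigma^{ln}\multimap\underline R)\otimes\tau^{ln}$; $\Theta^{ln}\multimap\underline R$ denotes $x_1{:}\sigma_1^{ln}\multimap\underline R,\ldots,x_n{:}\sigma_n^{ln}\multimap\underline R$. A judgement $\Theta\vdash M:\tau$ is sent to $\Theta^{ln}\multimap\underline R\mid-\vdash M^{ln}:\tau^{ln}\multimap\underline R$ where: $x^{ln}=x$; $*^{ln}=\hat\lambda k{:}\underline 0.\,\mathrm{abort}_{\underline R}(k)$; $\langle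 M,N\rangle^{ln}=\hat\lambda k{:}\sigma^{ln}\oplus\tau^{ln}.\,\mathrm{case}\ k\ \mathrm{of}\ (\mathrm{inl}\,x\Rightarrow M^{ln}\{x\}\mid\mathrm{inr}\,y\Rightarrow N^{ln}\{y\})$; $(\pi_1M)^{ln}=\hat\lambda k{:}\sigma^{ln}.\,M^{ln}\{\mathrm{inl}\,k\}$; $(\pi_2M)^{ln}=\hat\lambda k{:}\tau^{ln}.\,M^{ln}\{\mathrm{inr}\,k\}$; $(\lambda x{:}\sigma.M)^{ln}=\hat\lambda k{:}\,!(\sigma^{ln}\multimap\underline R)\otimes\tau^{ln}.\,\mathrm{let}\ !x\otimes h\ \mathrm{be}\ k\ \mathrm{in}\ M^{ln}\{h\}$; for $M:\sigma\to\tau$, $N:\sigma$: $(M\,N)^{ln}=\hat\lambda k{:}\tau^{ln}.\,M^{ln}\{!(N^{ln})\otimes k\}$. -}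

module Defs where

open import Data.Nat using (ℕ)

infixr 30 _⟶_
infixr 25 _⊸_
infixr 30 _⇒_
infixl 35 _&_
infixl 35 _⊕_
infixl 40 _×ᵛ_
infixl 5 _,_

data VTy : Set
data CTy : Set

data VTy where
  vα    : ℕ → VTy
  𝟙     : VTy
  _×ᵛ_  : VTy → VTy → VTy
  _⟶_   : VTy → VTy → VTy
  ⌈_⌉   : CTy → VTy
  _⊸_   : CTy → CTy → VTy

data CTy where
  cα    : ℕ → CTy
  𝟙c    : CTy
  _&_   : CTy → CTy → CTy
  _⇒_   : VTy → CTy → CTy
  I     : CTy
  !_    : VTy → CTy
  !_⊗_  : VTy → CTy → CTy         -- the primitive binary constructor !A ⊗ B
  𝟘     : CTy
  _⊕_   : CTy → CTy → CTy

data Ctx : Set where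
  ε   : Ctx
  _,_ : Ctx → VTy → Ctx

data Var : Ctx → VTy → Set where
  zero : ∀ {Γ A} → Var (Γ , A) A
  suc  : ∀ {Γ A B} → Var Γ A → Var (Γ , B) A

-- the stoup: empty, or one variable of computation type
data Stoup : Set where
  ∅   : Stoup
  ⟨_⟩ : CTy → Stoup

-- EEC terms, intrinsically typed:  Tm Γ Δ T  is  Γ | Δ ⊢ t : T.
-- Rules with a general stoup Δ only produce computation types, so a
-- term with non-empty stoup always has a computation type.

data Tm : Ctx → Stoup → VTy → Set where
  var       : ∀ {Γ A} → Var Γ A → Tm Γ ∅ A
  unit      : ∀ {Γ} → Tm Γ ∅ 𝟙
  pair      : ∀ {Γ A B} → Tm Γ ∅ A → Tm Γ ∅ B → Tm Γ ∅ (A ×ᵛ B)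
  fst       : ∀ {Γ A B} → Tm Γ ∅ (A ×ᵛ B) → Tm Γ ∅ A
  snd       : ∀ {Γ A B} → Tm Γ ∅ (A ×ᵛ B) → Tm Γ ∅ B
  lam       : ∀ {Γ A B} → Tm (Γ , A) ∅ B → Tm Γ ∅ (A ⟶ B)
  app       : ∀ {Γ A B} → Tm Γ ∅ (A ⟶ B) → Tm Γ ∅ A → Tm Γ ∅ B
  zvar      : ∀ {Γ A} → Tm Γ ⟨ A ⟩ ⌈ A ⌉
  cunit     : ∀ {Γ Δ} → Tm Γ Δ ⌈ 𝟙c ⌉
  cpair     : ∀ {Γ Δ A B} → Tm Γ Δ ⌈ A ⌉ → Tm Γ Δ ⌈ B ⌉ → Tm Γ Δ ⌈ A & B ⌉
  cfst      : ∀ {Γ Δ A B} → Tm Γ Δ ⌈ A & B ⌉ → Tm Γ Δ ⌈ A ⌉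
  csnd      : ∀ {Γ Δ A B} → Tm Γ Δ ⌈ A & B ⌉ → Tm Γ Δ ⌈ B ⌉
  clam      : ∀ {Γ Δ A B} → Tm (Γ , A) Δ ⌈ B ⌉ → Tm Γ Δ ⌈ A ⇒ B ⌉
  capp      : ∀ {Γ Δ A B} → Tm Γ Δ ⌈ A ⇒ B ⌉ → Tm Γ ∅ A → Tm Γ Δ ⌈ B ⌉
  top       : ∀ {Γ} → Tm Γ ∅ ⌈ I ⌉
  letTop    : ∀ {Γ Δ A} → Tm Γ Δ ⌈ I ⌉ → Tm Γ ∅ ⌈ A ⌉ → Tm Γ Δ ⌈ A ⌉
  bang      : ∀ {Γ A} → Tm Γ ∅ A → Tm Γ ∅ ⌈ ! A ⌉
  letBang   : ∀ {Γ Δ A B} → Tm Γ Δ ⌈ ! A ⌉ → Tm (Γ , A) ∅ ⌈ B ⌉ → Tm Γ Δ ⌈ B ⌉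
  tensor    : ∀ {Γ Δ A B} → Tm Γ ∅ A → Tm Γ Δ ⌈ B ⌉ → Tm Γ Δ ⌈ ! A ⊗ B ⌉
  letTensor : ∀ {Γ Δ A B C} → Tm Γ Δ ⌈ ! A ⊗ B ⌉ → Tm (Γ , A) ⟨ B ⟩ ⌈ C ⌉ → Tm Γ Δ ⌈ C ⌉
  abort     : ∀ {Γ Δ A} → Tm Γ Δ ⌈ 𝟘 ⌉ → Tm Γ Δ ⌈ A ⌉
  inl       : ∀ {Γ Δ A B} → Tm Γ Δ ⌈ A ⌉ → Tm Γ Δ ⌈ A ⊕ B ⌉
  inr       : ∀ {Γ Δ A B} → Tm Γ Δ ⌈ B ⌉ → Tm Γ Δ ⌈ A ⊕ B ⌉
  case      : ∀ {Γ Δ A B C} → Tm Γ Δ ⌈ A ⊕ B ⌉ → Tm Γ ⟨ A ⟩ ⌈ C ⌉ → Tm Γ ⟨ B ⟩ ⌈ C ⌉ → Tm Γ Δ ⌈ C ⌉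
  llam      : ∀ {Γ A B} → Tm Γ ⟨ A ⟩ ⌈ B ⌉ → Tm Γ ∅ (A ⊸ B)
  lapp      : ∀ {Γ Δ A B} → Tm Γ ∅ (A ⊸ B) → Tm Γ Δ ⌈ A ⌉ → Tm Γ Δ ⌈ B ⌉

Ren : Ctx → Ctx → Set
Ren Γ Γ' = ∀ {A} → Var Γ A → Var Γ' A

ext : ∀ {Γ Γ' B} → Ren Γ Γ' → Ren (Γ , B) (Γ' , B)
ext ρ zero    = zero
ext ρ (suc x) = suc (ρ x)

ren : ∀ {Γ Γ' Δ T} → Ren Γ Γ' → Tm Γ Δ T → Tm Γ' Δ T
ren ρ (var x)         = var (ρ x)
ren ρ unit            = unit
ren ρ (pair t u)      = pair (ren ρ t) (ren ρ u)
ren ρ (fst t)         = fst (ren ρ t)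
ren ρ (snd t)         = snd (ren ρ t)
ren ρ (lam t)         = lam (ren (ext ρ) t)
ren ρ (app t u)       = app (ren ρ t) (ren ρ u)
ren ρ zvar            = zvar
ren ρ cunit           = cunit
ren ρ (cpair t u)     = cpair (ren ρ t) (ren ρ u)
ren ρ (cfst t)        = cfst (ren ρ t)
ren ρ (csnd t)        = csnd (ren ρ t)
ren ρ (clam t)        = clam (ren (ext ρ) t)
ren ρ (capp t u)      = capp (ren ρ t) (ren ρ u)
ren ρ top             = top
ren ρ (letTop t u)    = letTop (ren ρ t) (ren ρ u)
ren ρ (bang t)        = bang (ren ρ t)
ren ρ (letBang t u)   = letBang (ren ρ t) (ren (ext ρ) u)
ren ρ (tensor t u)    = tensor (ren ρ t) (ren ρ u)
ren ρ (letTensor t u) = letTensor (ren ρ t) (ren (ext ρ) u)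
ren ρ (abort t)       = abort (ren ρ t)
ren ρ (inl t)         = inl (ren ρ t)
ren ρ (inr t)         = inr (ren ρ t)
ren ρ (case t u v)    = case (ren ρ t) (ren ρ u) (ren ρ v)
ren ρ (llam t)        = llam (ren ρ t)
ren ρ (lapp t u)      = lapp (ren ρ t) (ren ρ u)

wk : ∀ {Γ Δ T B} → Tm Γ Δ T → Tm (Γ , B) Δ T
wk = ren suc

Sub : Ctx → Ctx → Set
Sub Γ Γ' = ∀ {A} → Var Γ A → Tm Γ' ∅ A

exts : ∀ {Γ Γ' B} → Sub Γ Γ' → Sub (Γ , B) (Γ' , B)
exts σ zero    = var zero
exts σ (suc x) = wk (σ x)

sub : ∀ {Γ Γ' Δ T} → Sub Γ Γ' → Tm Γ Δ T → Tm Γ' Δ T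
sub σ (var x)         = σ x
sub σ unit            = unit
sub σ (pair t u)      = pair (sub σ t) (sub σ u)
sub σ (fst t)         = fst (sub σ t)
sub σ (snd t)         = snd (sub σ t)
sub σ (lam t)         = lam (sub (exts σ) t)
sub σ (app t u)       = app (sub σ t) (sub σ u)
sub σ zvar            = zvar
sub σ cunit           = cunit
sub σ (cpair t u)     = cpair (sub σ t) (sub σ u)
sub σ (cfst t)        = cfst (sub σ t)
sub σ (csnd t)        = csnd (sub σ t)
sub σ (clam t)        = clam (sub (exts σ) t)
sub σ (capp t u)      = capp (sub σ t) (sub σ u)
sub σ top             = top
sub σ (letTop t u)    = letTop (sub σ t) (sub σ u)
sub σ (bang t)        = bang (sub σ t)
sub σ (letBang t u)   = letBang (sub σ t) (sub (exts σ) u)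
sub σ (tensor t u)    = tensor (sub σ t) (sub σ u)
sub σ (letTensor t u) = letTensor (sub σ t) (sub (exts σ) u)
sub σ (abort t)       = abort (sub σ t)
sub σ (inl t)         = inl (sub σ t)
sub σ (inr t)         = inr (sub σ t)
sub σ (case t u v)    = case (sub σ t) (sub σ u) (sub σ v)
sub σ (llam t)        = llam (sub σ t)
sub σ (lapp t u)      = lapp (sub σ t) (sub σ u)

_[_] : ∀ {Γ Δ T A} → Tm (Γ , A) Δ T → Tm Γ ∅ A → Tm Γ Δ T
t [ u ] = sub σ t
  where
  σ : Sub (_ , _) _
  σ zero    = u
  σ (suc x) = var x

zsub : ∀ {Γ Δ A T} → Tm Γ ⟨ A ⟩ T → Tm Γ Δ ⌈ A ⌉ → Tm Γ Δ T
zsub zvar            s = s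
zsub cunit           s = cunit
zsub (cpair t u)     s = cpair (zsub t s) (zsub u s)
zsub (cfst t)        s = cfst (zsub t s)
zsub (csnd t)        s = csnd (zsub t s)
zsub (clam t)        s = clam (zsub t (wk s))
zsub (capp t u)      s = capp (zsub t s) u
zsub (letTop t u)    s = letTop (zsub t s) u
zsub (letBang t u)   s = letBang (zsub t s) u
zsub (tensor t u)    s = tensor t (zsub u s)
zsub (letTensor t u) s = letTensor (zsub t s) u
zsub (abort t)       s = abort (zsub t s)
zsub (inl t)         s = inl (zsub t s)
zsub (inr t)         s = inr (zsub t s)
zsub (case t u v)    s = case (zsub t s) u v
zsub (lapp t u)      s = lapp t (zsub u s)

infix 4 _≈_

data _≈_ : ∀ {Γ Δ T} → Tm Γ Δ T → Tm Γ Δ T → Set where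
  ≈refl  : ∀ {Γ Δ T} {t : Tm Γ Δ T} → t ≈ t
  ≈sym   : ∀ {Γ Δ T} {t u : Tm Γ Δ T} → t ≈ u → u ≈ t
  ≈trans : ∀ {Γ Δ T} {t u v : Tm Γ Δ T} → t ≈ u → u ≈ v → t ≈ v
  pair-cong  : ∀ {Γ A B} {t t' : Tm Γ ∅ A} {u u' : Tm Γ ∅ B} → t ≈ t' → u ≈ u' → pair t u ≈ pair t' u'
  fst-cong   : ∀ {Γ A B} {t t' : Tm Γ ∅ (A ×ᵛ B)} → t ≈ t' → fst t ≈ fst t'
  snd-cong   : ∀ {Γ A B} {t t' : Tm Γ ∅ (A ×ᵛ B)} → t ≈ t' → snd t ≈ snd t'
  lam-cong   : ∀ {Γ A B} {t t' : Tm (Γ , A) ∅ B} → t ≈ t' → lam t ≈ lam t'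
  app-cong   : ∀ {Γ A B} {t t' : Tm Γ ∅ (A ⟶ B)} {u u' : Tm Γ ∅ A} → t ≈ t' → u ≈ u' → app t u ≈ app t' u'
  cpair-cong : ∀ {Γ Δ A B} {t t' : Tm Γ Δ ⌈ A ⌉} {u u' : Tm Γ Δ ⌈ B ⌉} → t ≈ t' → u ≈ u' → cpair t u ≈ cpair t' u'
  cfst-cong  : ∀ {Γ Δ A B} {t t' : Tm Γ Δ ⌈ A & B ⌉} → t ≈ t' → cfst t ≈ cfst t'
  csnd-cong  : ∀ {Γ Δ A B} {t t' : Tm Γ Δ ⌈ A & B ⌉} → t ≈ t' → csnd t ≈ csnd t'
  clam-cong  : ∀ {Γ Δ A B} {t t' : Tm (Γ , A) Δ ⌈ B ⌉} → t ≈ t' → clam t ≈ clam t'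
  capp-cong  : ∀ {Γ Δ A B} {t t' : Tm Γ Δ ⌈ A ⇒ B ⌉} {u u' : Tm Γ ∅ A} → t ≈ t' → u ≈ u' → capp t u ≈ capp t' u'
  letTop-cong : ∀ {Γ Δ A} {t t' : Tm Γ Δ ⌈ I ⌉} {u u' : Tm Γ ∅ ⌈ A ⌉} → t ≈ t' → u ≈ u' → letTop t u ≈ letTop t' u'
  bang-cong  : ∀ {Γ A} {t t' : Tm Γ ∅ A} → t ≈ t' → bang t ≈ bang t'
  letBang-cong : ∀ {Γ Δ A B} {t t' : Tm Γ Δ ⌈ ! A ⌉} {u u' : Tm (Γ , A) ∅ ⌈ B ⌉} → t ≈ t' → u ≈ u' → letBang t u ≈ letBang t' u'
  tensor-cong : ∀ {Γ Δ A B} {t t' : Tm Γ ∅ A} {u u' : Tm Γ Δ ⌈ B ⌉} → t ≈ t' → u ≈ u' → tensor t u ≈ tensor t' u'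
  letTensor-cong : ∀ {Γ Δ A B C} {t t' : Tm Γ Δ ⌈ ! A ⊗ B ⌉} {u u' : Tm (Γ , A) ⟨ B ⟩ ⌈ C ⌉} → t ≈ t' → u ≈ u' → letTensor t u ≈ letTensor t' u'
  abort-cong : ∀ {Γ Δ A} {t t' : Tm Γ Δ ⌈ 𝟘 ⌉} → t ≈ t' → abort {A = A} t ≈ abort t'
  inl-cong   : ∀ {Γ Δ A B} {t t' : Tm Γ Δ ⌈ A ⌉} → t ≈ t' → inl {B = B} t ≈ inl t'
  inr-cong   : ∀ {Γ Δ A B} {t t' : Tm Γ Δ ⌈ B ⌉} → t ≈ t' → inr {A = A} t ≈ inr t'
  case-cong  : ∀ {Γ Δ A B C} {t t' : Tm Γ Δ ⌈ A ⊕ B ⌉} {u u' : Tm Γ ⟨ A ⟩ ⌈ C ⌉} {v v' : Tm Γ ⟨ B ⟩ ⌈ C ⌉} →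
               t ≈ t' → u ≈ u' → v ≈ v' → case t u v ≈ case t' u' v'
  llam-cong  : ∀ {Γ A B} {t t' : Tm Γ ⟨ A ⟩ ⌈ B ⌉} → t ≈ t' → llam t ≈ llam t'
  lapp-cong  : ∀ {Γ Δ A B} {t t' : Tm Γ ∅ (A ⊸ B)} {u u' : Tm Γ Δ ⌈ A ⌉} → t ≈ t' → u ≈ u' → lapp t u ≈ lapp t' u'
  η-𝟙   : ∀ {Γ} (t : Tm Γ ∅ 𝟙) → t ≈ unit
  β-×₁  : ∀ {Γ A B} (t : Tm Γ ∅ A) (u : Tm Γ ∅ B) → fst (pair t u) ≈ t
  β-×₂  : ∀ {Γ A B} (t : Tm Γ ∅ A) (u : Tm Γ ∅ B) → snd (pair t u) ≈ u
  η-×   : ∀ {Γ A B} (t : Tm Γ ∅ (A ×ᵛ B)) → pair (fst t) (snd t) ≈ t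
  β-⟶   : ∀ {Γ A B} (t : Tm (Γ , A) ∅ B) (u : Tm Γ ∅ A) → app (lam t) u ≈ t [ u ]
  η-⟶   : ∀ {Γ A B} (t : Tm Γ ∅ (A ⟶ B)) → lam (app (wk t) (var zero)) ≈ t
  η-𝟙c  : ∀ {Γ Δ} (t : Tm Γ Δ ⌈ 𝟙c ⌉) → t ≈ cunit
  β-&₁  : ∀ {Γ Δ A B} (t : Tm Γ Δ ⌈ A ⌉) (u : Tm Γ Δ ⌈ B ⌉) → cfst (cpair t u) ≈ t
  β-&₂  : ∀ {Γ Δ A B} (t : Tm Γ Δ ⌈ A ⌉) (u : Tm Γ Δ ⌈ B ⌉) → csnd (cpair t u) ≈ u
  η-&   : ∀ {Γ Δ A B} (t : Tm Γ Δ ⌈ A & B ⌉) → cpair (cfst t) (csnd t) ≈ t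
  β-⇒   : ∀ {Γ Δ A B} (t : Tm (Γ , A) Δ ⌈ B ⌉) (u : Tm Γ ∅ A) → capp (clam t) u ≈ t [ u ]
  η-⇒   : ∀ {Γ Δ A B} (t : Tm Γ Δ ⌈ A ⇒ B ⌉) → clam (capp (wk t) (var zero)) ≈ t
  β-I   : ∀ {Γ A} (t : Tm Γ ∅ ⌈ A ⌉) → letTop top t ≈ t
  η-I   : ∀ {Γ Δ A} (t : Tm Γ Δ ⌈ I ⌉) (u : Tm Γ ⟨ I ⟩ ⌈ A ⌉) → letTop t (zsub u top) ≈ zsub u t
  β-!   : ∀ {Γ A B} (t : Tm Γ ∅ A) (u : Tm (Γ , A) ∅ ⌈ B ⌉) → letBang (bang t) u ≈ u [ t ]
  η-!   : ∀ {Γ Δ A B} (t : Tm Γ Δ ⌈ ! A ⌉) (u : Tm Γ ⟨ ! A ⟩ ⌈ B ⌉) →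
          letBang t (zsub (wk u) (bang (var zero))) ≈ zsub u t
  β-⊗   : ∀ {Γ Δ A B C} (t : Tm Γ ∅ A) (s : Tm Γ Δ ⌈ B ⌉) (u : Tm (Γ , A) ⟨ B ⟩ ⌈ C ⌉) →
          letTensor (tensor t s) u ≈ zsub (u [ t ]) s
  η-⊗   : ∀ {Γ Δ A B C} (t : Tm Γ Δ ⌈ ! A ⊗ B ⌉) (u : Tm Γ ⟨ ! A ⊗ B ⟩ ⌈ C ⌉) →
          letTensor t (zsub (wk u) (tensor (var zero) zvar)) ≈ zsub u t
  η-𝟘   : ∀ {Γ Δ A} (t : Tm Γ Δ ⌈ 𝟘 ⌉) (u : Tm Γ ⟨ 𝟘 ⟩ ⌈ A ⌉) → abort t ≈ zsub u t
  β-⊕₁  : ∀ {Γ Δ A B C} (t : Tm Γ Δ ⌈ A ⌉) (u : Tm Γ ⟨ A ⟩ ⌈ C ⌉) (u' : Tm Γ ⟨ B ⟩ ⌈ C ⌉) →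
          case (inl t) u u' ≈ zsub u t
  β-⊕₂  : ∀ {Γ Δ A B C} (t : Tm Γ Δ ⌈ B ⌉) (u : Tm Γ ⟨ A ⟩ ⌈ C ⌉) (u' : Tm Γ ⟨ B ⟩ ⌈ C ⌉) →
          case (inr t) u u' ≈ zsub u' t
  η-⊕   : ∀ {Γ Δ A B C} (t : Tm Γ Δ ⌈ A ⊕ B ⌉) (u : Tm Γ ⟨ A ⊕ B ⟩ ⌈ C ⌉) →
          case t (zsub u (inl zvar)) (zsub u (inr zvar)) ≈ zsub u t
  β-⊸   : ∀ {Γ Δ A B} (t : Tm Γ ⟨ A ⟩ ⌈ B ⌉) (u : Tm Γ Δ ⌈ A ⌉) → lapp (llam t) u ≈ zsub t u
  η-⊸   : ∀ {Γ A B} (t : Tm Γ ∅ (A ⊸ B)) → llam (lapp t zvar) ≈ t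

infixr 30 _⇾_
infixl 40 _⊠_

data STy : Set where
  sα   : ℕ → STy
  s𝟙   : STy
  _⊠_  : STy → STy → STy
  _⇾_  : STy → STy → STy

data SCtx : Set where
  ε   : SCtx
  _,_ : SCtx → STy → SCtx

data SVar : SCtx → STy → Set where
  zero : ∀ {Θ σ} → SVar (Θ , σ) σ
  suc  : ∀ {Θ σ τ} → SVar Θ σ → SVar (Θ , τ) σ

data STm : SCtx → STy → Set where
  var  : ∀ {Θ σ} → SVar Θ σ → STm Θ σ
  unit : ∀ {Θ} → STm Θ s𝟙
  pair : ∀ {Θ σ τ} → STm Θ σ → STm Θ τ → STm Θ (σ ⊠ τ)
  fst  : ∀ {Θ σ τ} → STm Θ (σ ⊠ τ) → STm Θ σ
  snd  : ∀ {Θ σ τ} → STm Θ (σ ⊠ τ) → STm Θ τ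
  lam  : ∀ {Θ σ τ} → STm (Θ , σ) τ → STm Θ (σ ⇾ τ)
  app  : ∀ {Θ σ τ} → STm Θ (σ ⇾ τ) → STm Θ σ → STm Θ τ

SRen : SCtx → SCtx → Set
SRen Θ Θ' = ∀ {σ} → SVar Θ σ → SVar Θ' σ

sext : ∀ {Θ Θ' τ} → SRen Θ Θ' → SRen (Θ , τ) (Θ' , τ)
sext ρ zero    = zero
sext ρ (suc x) = suc (ρ x)

sren : ∀ {Θ Θ' σ} → SRen Θ Θ' → STm Θ σ → STm Θ' σ
sren ρ (var x)    = var (ρ x)
sren ρ unit       = unit
sren ρ (pair M N) = pair (sren ρ M) (sren ρ N)
sren ρ (fst M)    = fst (sren ρ M)
sren ρ (snd M)    = snd (sren ρ M)
sren ρ (lam M)    = lam (sren (sext ρ) M)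
sren ρ (app M N)  = app (sren ρ M) (sren ρ N)

SSub : SCtx → SCtx → Set
SSub Θ Θ' = ∀ {σ} → SVar Θ σ → STm Θ' σ

sexts : ∀ {Θ Θ' τ} → SSub Θ Θ' → SSub (Θ , τ) (Θ' , τ)
sexts σ zero    = var zero
sexts σ (suc x) = sren suc (σ x)

ssub : ∀ {Θ Θ' τ} → SSub Θ Θ' → STm Θ τ → STm Θ' τ
ssub σ (var x)    = σ x
ssub σ unit       = unit
ssub σ (pair M N) = pair (ssub σ M) (ssub σ N)
ssub σ (fst M)    = fst (ssub σ M)
ssub σ (snd M)    = snd (ssub σ M)
ssub σ (lam M)    = lam (ssub (sexts σ) M)
ssub σ (app M N)  = app (ssub σ M) (ssub σ N)

_⟪_⟫ : ∀ {Θ σ τ} → STm (Θ , σ) τ → STm Θ σ → STm Θ τ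
M ⟪ N ⟫ = ssub σ' M
  where
  σ' : SSub (_ , _) _
  σ' zero    = N
  σ' (suc x) = var x

infix 4 _=βη_

data _=βη_ : ∀ {Θ τ} → STm Θ τ → STm Θ τ → Set where
  refl'  : ∀ {Θ τ} {M : STm Θ τ} → M =βη M
  sym'   : ∀ {Θ τ} {M N : STm Θ τ} → M =βη N → N =βη M
  trans' : ∀ {Θ τ} {M N P : STm Θ τ} → M =βη N → N =βη P → M =βη P
  pair-cong : ∀ {Θ σ τ} {M M' : STm Θ σ} {N N' : STm Θ τ} → M =βη M' → N =βη N' → pair M N =βη pair M' N'
  fst-cong  : ∀ {Θ σ τ} {M M' : STm Θ (σ ⊠ τ)} → M =βη M' → fst M =βη fst M'
  snd-cong  : ∀ {Θ σ τ} {M M' : STm Θ (σ ⊠ τ)} → M =βη M' → snd M =βη snd M'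
  lam-cong  : ∀ {Θ σ τ} {M M' : STm (Θ , σ) τ} → M =βη M' → lam M =βη lam M'
  app-cong  : ∀ {Θ σ τ} {M M' : STm Θ (σ ⇾ τ)} {N N' : STm Θ σ} → M =βη M' → N =βη N' → app M N =βη app M' N'
  η-𝟙  : ∀ {Θ} (M : STm Θ s𝟙) → M =βη unit
  β-×₁ : ∀ {Θ σ τ} (M : STm Θ σ) (N : STm Θ τ) → fst (pair M N) =βη M
  β-×₂ : ∀ {Θ σ τ} (M : STm Θ σ) (N : STm Θ τ) → snd (pair M N) =βη N
  η-×  : ∀ {Θ σ τ} (M : STm Θ (σ ⊠ τ)) → pair (fst M) (snd M) =βη M
  β-⇾  : ∀ {Θ σ τ} (M : STm (Θ , σ) τ) (N : STm Θ σ) → app (lam M) N =βη M ⟪ N ⟫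
  η-⇾  : ∀ {Θ σ τ} (M : STm Θ (σ ⇾ τ)) → lam (app (sren suc M) (var zero)) =βη M

module CPS (R : CTy) where

  infix 50 _ˡⁿ

  _ˡⁿ : STy → CTy
  sα n ˡⁿ    = cα n
  s𝟙 ˡⁿ      = 𝟘
  (σ ⊠ τ) ˡⁿ = σ ˡⁿ ⊕ τ ˡⁿ
  (σ ⇾ τ) ˡⁿ = ! (σ ˡⁿ ⊸ R) ⊗ τ ˡⁿ

  ctxˡⁿ : SCtx → Ctx
  ctxˡⁿ ε       = ε
  ctxˡⁿ (Θ , σ) = ctxˡⁿ Θ , (σ ˡⁿ ⊸ R)

  varˡⁿ : ∀ {Θ σ} → SVar Θ σ → Var (ctxˡⁿ Θ) (σ ˡⁿ ⊸ R)
  varˡⁿ zero    = zero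
  varˡⁿ (suc x) = suc (varˡⁿ x)

  tmˡⁿ : ∀ {Θ τ} → STm Θ τ → Tm (ctxˡⁿ Θ) ∅ (τ ˡⁿ ⊸ R)
  tmˡⁿ (var x)    = var (varˡⁿ x)
  tmˡⁿ unit       = llam (abort zvar)
  tmˡⁿ (pair M N) = llam (case zvar (lapp (tmˡⁿ M) zvar) (lapp (tmˡⁿ N) zvar))
  tmˡⁿ (fst M)    = llam (lapp (tmˡⁿ M) (inl zvar))
  tmˡⁿ (snd M)    = llam (lapp (tmˡⁿ M) (inr zvar))
  tmˡⁿ (lam M)    = llam (letTensor zvar (lapp (tmˡⁿ M) zvar))
  tmˡⁿ (app M N)  = llam (lapp (tmˡⁿ M) (tensor (tmˡⁿ N) zvar))

module Submission where

open import Defs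
open import Relation.Binary.PropositionalEquality using (_≡_; refl; cong; cong₂; sym; trans)

-- Congruence
-- rules are mapped to EEC congruence rules, since the translation is
-- compositional.  Each βη-axiom becomes an instance of a small EEC law
-- about the combinators the translation is built from: linear
-- extensionality (η for ⊸) lets us compare a term t with a linear
-- abstraction by applying both to the stoup variable, after which the
-- β/η-laws of 𝟘, ⊕ and !A ⊗ B finish the job.
--
-- The λ-calculus β- and η-axioms involve substitution and weakening, so
-- we also show that the translation commutes with both: a renaming or
-- substitution of λ-terms induces one on the translated contexts, and
-- translating a renamed/substituted term equals renaming/substituting
-- its translation.

cong₃ : ∀ {A B C D : Set} (f : A → B → C → D) {a a' b b' c c'} →
        a ≡ a' → b ≡ b' → c ≡ c' → f a b c ≡ f a' b' c'
cong₃ f refl refl refl = refl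

≡→≈ : ∀ {Γ Δ T} {t u : Tm Γ Δ T} → t ≡ u → t ≈ u
≡→≈ refl = ≈refl

-- EEC renaming and substitution respect pointwise equality of their maps.
-- (Without function extensionality this must be proved by induction.)

ext-cong : ∀ {Γ Γ' B} {ρ ρ' : Ren Γ Γ'} → (∀ {A} (x : Var Γ A) → ρ x ≡ ρ' x) →
           ∀ {A} (x : Var (Γ , B) A) → ext ρ x ≡ ext ρ' x
ext-cong e zero    = refl
ext-cong e (suc x) = cong suc (e x)

ren-cong : ∀ {Γ Γ' Δ T} {ρ ρ' : Ren Γ Γ'} → (∀ {A} (x : Var Γ A) → ρ x ≡ ρ' x) →
           (t : Tm Γ Δ T) → ren ρ t ≡ ren ρ' t
ren-cong e (var x)         = cong var (e x)
ren-cong e unit            = refl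
ren-cong e (pair t u)      = cong₂ pair (ren-cong e t) (ren-cong e u)
ren-cong e (fst t)         = cong fst (ren-cong e t)
ren-cong e (snd t)         = cong snd (ren-cong e t)
ren-cong e (lam t)         = cong lam (ren-cong (ext-cong e) t)
ren-cong e (app t u)       = cong₂ app (ren-cong e t) (ren-cong e u)
ren-cong e zvar            = refl
ren-cong e cunit           = refl
ren-cong e (cpair t u)     = cong₂ cpair (ren-cong e t) (ren-cong e u)
ren-cong e (cfst t)        = cong cfst (ren-cong e t)
ren-cong e (csnd t)        = cong csnd (ren-cong e t)
ren-cong e (clam t)        = cong clam (ren-cong (ext-cong e) t)
ren-cong e (capp t u)      = cong₂ capp (ren-cong e t) (ren-cong e u)
ren-cong e top             = refl
ren-cong e (letTop t u)    = cong₂ letTop (ren-cong e t) (ren-cong e u)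
ren-cong e (bang t)        = cong bang (ren-cong e t)
ren-cong e (letBang t u)   = cong₂ letBang (ren-cong e t) (ren-cong (ext-cong e) u)
ren-cong e (tensor t u)    = cong₂ tensor (ren-cong e t) (ren-cong e u)
ren-cong e (letTensor t u) = cong₂ letTensor (ren-cong e t) (ren-cong (ext-cong e) u)
ren-cong e (abort t)       = cong abort (ren-cong e t)
ren-cong e (inl t)         = cong inl (ren-cong e t)
ren-cong e (inr t)         = cong inr (ren-cong e t)
ren-cong e (case t u v)    = cong₃ case (ren-cong e t) (ren-cong e u) (ren-cong e v)
ren-cong e (llam t)        = cong llam (ren-cong e t)
ren-cong e (lapp t u)      = cong₂ lapp (ren-cong e t) (ren-cong e u)

exts-cong : ∀ {Γ Γ' B} {σ σ' : Sub Γ Γ'} → (∀ {A} (x : Var Γ A) → σ x ≡ σ' x) →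
            ∀ {A} (x : Var (Γ , B) A) → exts σ x ≡ exts σ' x
exts-cong e zero    = refl
exts-cong e (suc x) = cong wk (e x)

sub-cong : ∀ {Γ Γ' Δ T} {σ σ' : Sub Γ Γ'} → (∀ {A} (x : Var Γ A) → σ x ≡ σ' x) →
           (t : Tm Γ Δ T) → sub σ t ≡ sub σ' t
sub-cong e (var x)         = e x
sub-cong e unit            = refl
sub-cong e (pair t u)      = cong₂ pair (sub-cong e t) (sub-cong e u)
sub-cong e (fst t)         = cong fst (sub-cong e t)
sub-cong e (snd t)         = cong snd (sub-cong e t)
sub-cong e (lam t)         = cong lam (sub-cong (exts-cong e) t)
sub-cong e (app t u)       = cong₂ app (sub-cong e t) (sub-cong e u)
sub-cong e zvar            = refl
sub-cong e cunit           = refl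
sub-cong e (cpair t u)     = cong₂ cpair (sub-cong e t) (sub-cong e u)
sub-cong e (cfst t)        = cong cfst (sub-cong e t)
sub-cong e (csnd t)        = cong csnd (sub-cong e t)
sub-cong e (clam t)        = cong clam (sub-cong (exts-cong e) t)
sub-cong e (capp t u)      = cong₂ capp (sub-cong e t) (sub-cong e u)
sub-cong e top             = refl
sub-cong e (letTop t u)    = cong₂ letTop (sub-cong e t) (sub-cong e u)
sub-cong e (bang t)        = cong bang (sub-cong e t)
sub-cong e (letBang t u)   = cong₂ letBang (sub-cong e t) (sub-cong (exts-cong e) u)
sub-cong e (tensor t u)    = cong₂ tensor (sub-cong e t) (sub-cong e u)
sub-cong e (letTensor t u) = cong₂ letTensor (sub-cong e t) (sub-cong (exts-cong e) u)
sub-cong e (abort t)       = cong abort (sub-cong e t)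
sub-cong e (inl t)         = cong inl (sub-cong e t)
sub-cong e (inr t)         = cong inr (sub-cong e t)
sub-cong e (case t u v)    = cong₃ case (sub-cong e t) (sub-cong e u) (sub-cong e v)
sub-cong e (llam t)        = cong llam (sub-cong e t)
sub-cong e (lapp t u)      = cong₂ lapp (sub-cong e t) (sub-cong e u)

⊸-ext : ∀ {Γ A B} {t : Tm Γ ∅ (A ⊸ B)} {b : Tm Γ ⟨ A ⟩ ⌈ B ⌉} →
        b ≈ lapp t zvar → llam b ≈ t
⊸-ext b≈tz = ≈trans (llam-cong b≈tz) (η-⊸ _)

abort-unique : ∀ {Γ C} (t : Tm Γ ∅ (𝟘 ⊸ C)) → llam (abort zvar) ≈ t
abort-unique t = ⊸-ext (η-𝟘 zvar (lapp t zvar))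

copair-inl : ∀ {Γ A B C} (m : Tm Γ ∅ (A ⊸ C)) (n : Tm Γ ∅ (B ⊸ C)) →
             llam (lapp (llam (case zvar (lapp m zvar) (lapp n zvar))) (inl zvar)) ≈ m
copair-inl m n = ⊸-ext (≈trans (β-⊸ _ _) (β-⊕₁ _ _ _))

copair-inr : ∀ {Γ A B C} (m : Tm Γ ∅ (A ⊸ C)) (n : Tm Γ ∅ (B ⊸ C)) →
             llam (lapp (llam (case zvar (lapp m zvar) (lapp n zvar))) (inr zvar)) ≈ n
copair-inr m n = ⊸-ext (≈trans (β-⊸ _ _) (β-⊕₂ _ _ _))

copair-η : ∀ {Γ A B C} (t : Tm Γ ∅ (A ⊕ B ⊸ C)) →
           llam (case zvar (lapp (llam (lapp t (inl zvar))) zvar)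
                           (lapp (llam (lapp t (inr zvar))) zvar)) ≈ t
copair-η t = ⊸-ext (≈trans (case-cong ≈refl (β-⊸ _ _) (β-⊸ _ _)) (η-⊕ zvar (lapp t zvar)))

tensor-β : ∀ {Γ A B C} (m : Tm (Γ , A) ∅ (B ⊸ C)) (n : Tm Γ ∅ A) →
           llam (lapp (llam (letTensor zvar (lapp m zvar))) (tensor n zvar)) ≈ m [ n ]
tensor-β m n = ⊸-ext (≈trans (β-⊸ _ _) (β-⊗ _ _ _))

tensor-η : ∀ {Γ A B C} (t : Tm Γ ∅ ((! A ⊗ B) ⊸ C)) →
           llam (letTensor zvar (lapp (llam (lapp (wk t) (tensor (var zero) zvar))) zvar)) ≈ t
tensor-η t = ⊸-ext (≈trans (letTensor-cong ≈refl (β-⊸ _ _)) (η-⊗ zvar (lapp t zvar)))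

module Translation (R : CTy) where
  open CPS R

  renˡⁿ : ∀ {Θ Θ'} → SRen Θ Θ' → Ren (ctxˡⁿ Θ) (ctxˡⁿ Θ')
  renˡⁿ {Θ , τ} ρ zero    = varˡⁿ (ρ zero)
  renˡⁿ {Θ , τ} ρ (suc x) = renˡⁿ (λ y → ρ (suc y)) x

  renˡⁿ-var : ∀ {Θ Θ' σ} (ρ : SRen Θ Θ') (x : SVar Θ σ) → renˡⁿ ρ (varˡⁿ x) ≡ varˡⁿ (ρ x)
  renˡⁿ-var ρ zero    = refl
  renˡⁿ-var ρ (suc x) = renˡⁿ-var (λ y → ρ (suc y)) x

  renˡⁿ-suc : ∀ {Θ Θ' τ A} (ρ : SRen Θ Θ') (x : Var (ctxˡⁿ Θ) A) →
              renˡⁿ (λ y → suc {τ = τ} (ρ y)) x ≡ suc (renˡⁿ ρ x)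
  renˡⁿ-suc {Θ , σ} ρ zero    = refl
  renˡⁿ-suc {Θ , σ} ρ (suc x) = renˡⁿ-suc (λ y → ρ (suc y)) x

  renˡⁿ-id : ∀ {Θ A} (x : Var (ctxˡⁿ Θ) A) → renˡⁿ (λ y → y) x ≡ x
  renˡⁿ-id {Θ , σ} zero    = refl
  renˡⁿ-id {Θ , σ} (suc x) = trans (renˡⁿ-suc (λ y → y) x) (cong suc (renˡⁿ-id x))

  renˡⁿ-wk : ∀ {Θ τ A} (x : Var (ctxˡⁿ Θ) A) → renˡⁿ (suc {τ = τ}) x ≡ suc x
  renˡⁿ-wk x = trans (renˡⁿ-suc (λ y → y) x) (cong suc (renˡⁿ-id x))

  renˡⁿ-ext : ∀ {Θ Θ' τ A} (ρ : SRen Θ Θ') (x : Var (ctxˡⁿ (Θ , τ)) A) →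
              renˡⁿ (sext ρ) x ≡ ext (renˡⁿ ρ) x
  renˡⁿ-ext ρ zero    = refl
  renˡⁿ-ext ρ (suc x) = renˡⁿ-suc ρ x

  tmˡⁿ-ren : ∀ {Θ Θ' τ} (ρ : SRen Θ Θ') (M : STm Θ τ) → tmˡⁿ (sren ρ M) ≡ ren (renˡⁿ ρ) (tmˡⁿ M)
  tmˡⁿ-ren ρ (var x)    = cong var (sym (renˡⁿ-var ρ x))
  tmˡⁿ-ren ρ unit       = refl
  tmˡⁿ-ren ρ (pair M N) = cong₂ (λ m n → llam (case zvar (lapp m zvar) (lapp n zvar)))
                                (tmˡⁿ-ren ρ M) (tmˡⁿ-ren ρ N)
  tmˡⁿ-ren ρ (fst M)    = cong (λ m → llam (lapp m (inl zvar))) (tmˡⁿ-ren ρ M)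
  tmˡⁿ-ren ρ (snd M)    = cong (λ m → llam (lapp m (inr zvar))) (tmˡⁿ-ren ρ M)
  tmˡⁿ-ren ρ (lam M)    = cong (λ m → llam (letTensor zvar (lapp m zvar)))
                               (trans (tmˡⁿ-ren (sext ρ) M) (ren-cong (renˡⁿ-ext ρ) (tmˡⁿ M)))
  tmˡⁿ-ren ρ (app M N)  = cong₂ (λ m n → llam (lapp m (tensor n zvar))) (tmˡⁿ-ren ρ M) (tmˡⁿ-ren ρ N)

  tmˡⁿ-wk : ∀ {Θ σ τ} (M : STm Θ τ) → tmˡⁿ (sren (suc {τ = σ}) M) ≡ wk (tmˡⁿ M)
  tmˡⁿ-wk M = trans (tmˡⁿ-ren suc M) (ren-cong renˡⁿ-wk (tmˡⁿ M))

  subˡⁿ : ∀ {Θ Θ'} → SSub Θ Θ' → Sub (ctxˡⁿ Θ) (ctxˡⁿ Θ')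
  subˡⁿ {Θ , τ} σ zero    = tmˡⁿ (σ zero)
  subˡⁿ {Θ , τ} σ (suc x) = subˡⁿ (λ y → σ (suc y)) x

  subˡⁿ-var : ∀ {Θ Θ' σ'} (σ : SSub Θ Θ') (x : SVar Θ σ') → subˡⁿ σ (varˡⁿ x) ≡ tmˡⁿ (σ x)
  subˡⁿ-var σ zero    = refl
  subˡⁿ-var σ (suc x) = subˡⁿ-var (λ y → σ (suc y)) x

  subˡⁿ-ren : ∀ {Θ Θ' Θ'' A} (ρ : SRen Θ' Θ'') (σ : SSub Θ Θ') (x : Var (ctxˡⁿ Θ) A) →
              subˡⁿ (λ y → sren ρ (σ y)) x ≡ ren (renˡⁿ ρ) (subˡⁿ σ x)
  subˡⁿ-ren {Θ , τ} ρ σ zero    = tmˡⁿ-ren ρ (σ zero)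
  subˡⁿ-ren {Θ , τ} ρ σ (suc x) = subˡⁿ-ren ρ (λ y → σ (suc y)) x

  subˡⁿ-exts : ∀ {Θ Θ' τ A} (σ : SSub Θ Θ') (x : Var (ctxˡⁿ (Θ , τ)) A) →
               subˡⁿ (sexts σ) x ≡ exts (subˡⁿ σ) x
  subˡⁿ-exts σ zero    = refl
  subˡⁿ-exts σ (suc x) = trans (subˡⁿ-ren suc σ x) (ren-cong renˡⁿ-wk (subˡⁿ σ x))

  subˡⁿ-vars : ∀ {Θ Θ' A} (ρ : SRen Θ Θ') (x : Var (ctxˡⁿ Θ) A) →
               subˡⁿ (λ y → var (ρ y)) x ≡ var (renˡⁿ ρ x)
  subˡⁿ-vars {Θ , τ} ρ zero    = refl
  subˡⁿ-vars {Θ , τ} ρ (suc x) = subˡⁿ-vars (λ y → ρ (suc y)) x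

  tmˡⁿ-sub : ∀ {Θ Θ' τ} (σ : SSub Θ Θ') (M : STm Θ τ) → tmˡⁿ (ssub σ M) ≡ sub (subˡⁿ σ) (tmˡⁿ M)
  tmˡⁿ-sub σ (var x)    = sym (subˡⁿ-var σ x)
  tmˡⁿ-sub σ unit       = refl
  tmˡⁿ-sub σ (pair M N) = cong₂ (λ m n → llam (case zvar (lapp m zvar) (lapp n zvar)))
                                (tmˡⁿ-sub σ M) (tmˡⁿ-sub σ N)
  tmˡⁿ-sub σ (fst M)    = cong (λ m → llam (lapp m (inl zvar))) (tmˡⁿ-sub σ M)
  tmˡⁿ-sub σ (snd M)    = cong (λ m → llam (lapp m (inr zvar))) (tmˡⁿ-sub σ M)
  tmˡⁿ-sub σ (lam M)    = cong (λ m → llam (letTensor zvar (lapp m zvar)))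
                               (trans (tmˡⁿ-sub (sexts σ) M) (sub-cong (subˡⁿ-exts σ) (tmˡⁿ M)))
  tmˡⁿ-sub σ (app M N)  = cong₂ (λ m n → llam (lapp m (tensor n zvar))) (tmˡⁿ-sub σ M) (tmˡⁿ-sub σ N)

  tmˡⁿ-[] : ∀ {Θ σ τ} (M : STm (Θ , σ) τ) (N : STm Θ σ) → tmˡⁿ (M ⟪ N ⟫) ≡ tmˡⁿ M [ tmˡⁿ N ]
  tmˡⁿ-[] M N = trans (tmˡⁿ-sub _ M) (sub-cong (λ { zero → refl
                                                 ; (suc x) → trans (subˡⁿ-vars (λ y → y) x)
                                                                   (cong var (renˡⁿ-id x)) })
                                               (tmˡⁿ M))

  soundness : ∀ {Θ τ} {M N : STm Θ τ} → M =βη N → tmˡⁿ M ≈ tmˡⁿ N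
  soundness refl'           = ≈refl
  soundness (sym' p)        = ≈sym (soundness p)
  soundness (trans' p q)    = ≈trans (soundness p) (soundness q)
  soundness (pair-cong p q) = llam-cong (case-cong ≈refl (lapp-cong (soundness p) ≈refl)
                                                         (lapp-cong (soundness q) ≈refl))
  soundness (fst-cong p)    = llam-cong (lapp-cong (soundness p) ≈refl)
  soundness (snd-cong p)    = llam-cong (lapp-cong (soundness p) ≈refl)
  soundness (lam-cong p)    = llam-cong (letTensor-cong ≈refl (lapp-cong (soundness p) ≈refl))
  soundness (app-cong p q)  = llam-cong (lapp-cong (soundness p) (tensor-cong (soundness q) ≈refl))
  soundness (η-𝟙 M)         = ≈sym (abort-unique (tmˡⁿ M))
  soundness (β-×₁ M N)      = copair-inl (tmˡⁿ M) (tmˡⁿ N)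
  soundness (β-×₂ M N)      = copair-inr (tmˡⁿ M) (tmˡⁿ N)
  soundness (η-× M)         = copair-η (tmˡⁿ M)
  soundness (β-⇾ M N)       = ≈trans (tensor-β (tmˡⁿ M) (tmˡⁿ N)) (≡→≈ (sym (tmˡⁿ-[] M N)))
  soundness (η-⇾ M)         =
    ≈trans (≡→≈ (cong (λ m → llam (letTensor zvar (lapp (llam (lapp m (tensor (var zero) zvar))) zvar)))
                      (tmˡⁿ-wk M)))
           (tensor-η (tmˡⁿ M))

proposition4p2 : (R : CTy) {Θ : SCtx} {τ : STy} (M N : STm Θ τ) →
    M =βη N → CPS.tmˡⁿ R M ≈ CPS.tmˡⁿ R N
proposition4p2 R M N M=N = Translation.soundness R M=N
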